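{- Suppose there is an algorithm which takes as input a Diophantine equation (a polynomial equation $D(x_1,\ldots,x_n)=0$ with $D$ having integer coefficients) and returns an integer which is greater than the number of integer solutions of the equation whenever this number is finite. Then there is an algorithm which takes as input a Diophantine equation and returns an integer which is greater than the heights of all integer solutions of the equation whenever the set of integer solutions is finite.
   Context: The height of an integer tuple $(a_1,\ldots,a_n)$ is $\max(|a_1|,\ldots,|a_n|)$. -}

module Defs where

open import Data.Nat using (ℕ; _⊔_)
open import Data.Integer using (ℤ; +_; _+_; _*_; _<_; ∣_∣)
open import Data.Fin using (Fin)
open import Data.Vec using (Vec; lookup; foldr′; map)
open import Data.List using (List; length)
open import Data.List.Membership.Propositional using (_∈_)
open import Data.List.Relation.Unary.Unique.Propositional using (Unique)
open import Data.Product using (_×_)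
open import Relation.Binary.PropositionalEquality using (_≡_)

-- Polynomials with integer coefficients in n variables x₁ … xₙ,
-- given as expressions (the input format of an algorithm).
data Poly (n : ℕ) : Set where
  const : ℤ → Poly n
  var   : Fin n → Poly n
  _⊕_   : Poly n → Poly n → Poly n
  _⊗_   : Poly n → Poly n → Poly n

eval : ∀ {n} → Poly n → Vec ℤ n → ℤ
eval (const c) x = c
eval (var i)   x = lookup x i
eval (p ⊕ q)   x = eval p x + eval q x
eval (p ⊗ q)   x = eval p x * eval q x

IsSolution : ∀ {n} → Poly n → Vec ℤ n → Set
IsSolution D x = eval D x ≡ + 0

height : ∀ {n} → Vec ℤ n → ℕ
height x = foldr′ _⊔_ 0 (map ∣_∣ x)

-- l is a duplicate-free list enumerating exactly the integer solutions of D = 0.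
-- The solution set is finite iff such an l exists, and then its number is length l.
Enumerates : ∀ {n} → Poly n → List (Vec ℤ n) → Set
Enumerates D l = Unique l × (∀ x → (x ∈ l → IsSolution D x) × (IsSolution D x → x ∈ l))

-- An algorithm (Agda function) bounding the number of solutions when finite.
BoundsCount : ((n : ℕ) → Poly n → ℤ) → Set
BoundsCount f = ∀ n (D : Poly n) (l : List (Vec ℤ n)) → Enumerates D l → + length l < f n D

BoundsHeights : ((n : ℕ) → Poly n → ℤ) → Set
BoundsHeights g = ∀ n (D : Poly n) (l : List (Vec ℤ n)) → Enumerates D l →
                  ∀ x → IsSolution D x → + height x < g n D

module Submission where

-- For D(x₁, …, xₙ) = 0 consider the auxiliary equation in n + 8
-- unknowns
--     D(x)² + (u₁² + ⋯ + u₄² + v₁² + ⋯ + v₄² − x₁² − ⋯ − xₙ²)² = 0,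
-- whose solutions are the (x, u, v) with D(x) = 0 and |u|² + |v|² = |x|².
-- If D has finitely many solutions, all solutions of the auxiliary equation lie in a
-- box, so a finite search enumerates them. A solution x of height h ≤ |x|² gives the
-- h + 1 distinct solutions (x, u, v) with |u|² = t and |v|² = |x|² − t, t = 0, …, h,
-- which exist by Lagrange's four-square theorem. Hence h is smaller than the number
-- of solutions of the auxiliary equation, which f bounds.

open import Defs
open import Data.Nat as ℕ using (ℕ; zero; suc; z≤n; s≤s; z<s)
import Data.Nat.Properties as ℕP
import Data.Nat.Tactic.RingSolver as ℕRing
open import Data.Nat.DivMod using (m≡m%n+[m/n]*n; m%n<n; m/n*n≤m)
open import Data.Nat.Divisibility as ℕ∣ using (divides; _∣0; >⇒∤)
open import Data.Nat.Induction using (<-rec)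
open import Data.Nat.ListAction using (product)
open import Data.Nat.Primality using (Prime; composite; prime⇒nonZero; prime⇒nonTrivial; euclidsLemma)
open import Data.Nat.Primality.Factorisation using (factorise; PrimeFactorisation)
open import Data.Integer as ℤ using (ℤ; +_; -[1+_]; _+_; _*_; _-_; -_; ∣_∣; +<+)
import Data.Integer.Properties as ℤP
open import Data.Integer.DivMod using (_%ℕ_; _/ℕ_; a≡a%ℕn+[a/ℕn]*n; n%ℕd<d)
open import Data.Integer.Divisibility.Signed as ℤ∣ using (_∣_; ∣m∣n⇒∣m+n; ∣m⇒∣m*n; ∣m⇒∣-m; ∣ᵤ⇒∣; ∣⇒∣ᵤ)
open import Data.Integer.Tactic.RingSolver using (solve-∀)
open import Data.Fin as Fin using (Fin; toℕ; fromℕ<; _↑ˡ_; _↑ʳ_)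
import Data.Fin.Properties as FinP
open import Data.Vec as Vec using (Vec; []; _∷_; lookup; tabulate; _++_; map)
import Data.Vec.Properties as VecP
open import Data.Vec.Relation.Unary.All as All using (All; []; _∷_)
open import Data.Vec.Relation.Unary.All.Properties using (++⁺)
open import Data.List as List using (List; length; filter; deduplicate; cartesianProductWith)
import Data.List.Relation.Unary.All as ListAll
open import Data.List.Membership.Propositional using (_∈_)
import Data.List.Membership.Propositional.Properties as ∈P
open import Data.List.Relation.Unary.Any using (here; there; index)
import Data.List.Relation.Unary.Any.Properties as AnyP
open import Data.List.Relation.Unary.Unique.DecPropositional.Properties using (deduplicate-!)
open import Data.Product using (Σ; _,_; _×_; proj₁; proj₂)
open import Data.Sum using (_⊎_; inj₁; inj₂; [_,_]′)
open import Data.Empty using (⊥; ⊥-elim)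
open import Function using (id; _∘_)
open import Relation.Nullary using (¬_; yes; no)
open import Relation.Binary.Definitions using (DecidableEquality; tri<; tri≈; tri>)
open import Relation.Unary using (Decidable)
open import Relation.Binary.PropositionalEquality

sumSq : ∀ {k} → Vec ℤ k → ℤ
sumSq []      = + 0
sumSq (a ∷ v) = a * a + sumSq v

sumSqℕ : ∀ {k} → Vec ℤ k → ℕ
sumSqℕ []      = 0
sumSqℕ (a ∷ v) = ∣ a ∣ ℕ.* ∣ a ∣ ℕ.+ sumSqℕ v

Bounded : ∀ {k} → ℕ → Vec ℤ k → Set
Bounded B = All (λ a → ∣ a ∣ ℕ.≤ B)

square-abs : ∀ a → a * a ≡ + (∣ a ∣ ℕ.* ∣ a ∣)
square-abs (+ n)    = sym (ℤP.pos-* n n)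
square-abs -[1+ n ] = refl

sumSq≡sumSqℕ : ∀ {k} (v : Vec ℤ k) → sumSq v ≡ + sumSqℕ v
sumSq≡sumSqℕ []      = refl
sumSq≡sumSqℕ (a ∷ v) =
  trans (cong₂ _+_ (square-abs a) (sumSq≡sumSqℕ v)) (sym (ℤP.pos-+ _ (sumSqℕ v)))

FourSquares : ℤ → Set
FourSquares n = Σ (Vec ℤ 4) λ v → sumSq v ≡ n

euler-identity : ∀ a b c d x y z w →
  (a * a + (b * b + (c * c + (d * d + + 0)))) * (x * x + (y * y + (z * z + (w * w + + 0)))) ≡
  (a * x + b * y + c * z + d * w) * (a * x + b * y + c * z + d * w) +
  ((a * y - b * x + c * w - d * z) * (a * y - b * x + c * w - d * z) +
  ((a * z - b * w - c * x + d * y) * (a * z - b * w - c * x + d * y) +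
  ((a * w + b * z - c * y - d * x) * (a * w + b * z - c * y - d * x) + + 0)))
euler-identity = solve-∀

eulerProduct : Vec ℤ 4 → Vec ℤ 4 → Vec ℤ 4
eulerProduct (a ∷ b ∷ c ∷ d ∷ []) (x ∷ y ∷ z ∷ w ∷ []) =
  (a * x + b * y + c * z + d * w) ∷ (a * y - b * x + c * w - d * z) ∷
  (a * z - b * w - c * x + d * y) ∷ (a * w + b * z - c * y - d * x) ∷ []

sumSq-eulerProduct : ∀ u v → sumSq u * sumSq v ≡ sumSq (eulerProduct u v)
sumSq-eulerProduct (a ∷ b ∷ c ∷ d ∷ []) (x ∷ y ∷ z ∷ w ∷ []) = euler-identity a b c d x y z w

fourSquares-* : ∀ {m n} → FourSquares m → FourSquares n → FourSquares (m * n)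
fourSquares-* (u , refl) (v , refl) = eulerProduct u v , sym (sumSq-eulerProduct u v)

dot : ∀ {k} → Vec ℤ k → Vec ℤ k → ℤ
dot []      []      = + 0
dot (a ∷ u) (b ∷ v) = a * b + dot u v

shift : ∀ {k} → ℤ → Vec ℤ k → Vec ℤ k → Vec ℤ k
shift m []      []      = []
shift m (a ∷ y) (b ∷ q) = a + m * b ∷ shift m y q

double : ∀ {k} → Vec ℤ k → Vec ℤ k
double []      = []
double (a ∷ y) = + 2 * a ∷ double y

sumSq-shift : ∀ {k} m (y q : Vec ℤ k) →
  sumSq (shift m y q) ≡ sumSq y + m * (dot (double y) q + m * sumSq q)
sumSq-shift m []      []      = expand m
  where
  expand : ∀ m → + 0 ≡ + 0 + m * (+ 0 + m * + 0)
  expand = solve-∀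
sumSq-shift m (a ∷ y) (b ∷ q) = trans (cong (λ S → (a + m * b) * (a + m * b) + S) (sumSq-shift m y q))
                                       (step m a b (sumSq y) (dot (double y) q) (sumSq q))
  where
  step : ∀ m a b S D Q → (a + m * b) * (a + m * b) + (S + m * (D + m * Q))
                       ≡ a * a + S + m * (+ 2 * a * b + D + m * (b * b + Q))
  step = solve-∀

sumSqℕ-double : ∀ {k} (y : Vec ℤ k) → sumSqℕ (double y) ≡ 4 ℕ.* sumSqℕ y
sumSqℕ-double []      = refl
sumSqℕ-double (a ∷ y) rewrite ℤP.abs-* (+ 2) a | sumSqℕ-double y = step ∣ a ∣ (sumSqℕ y)
  where
  step : ∀ a S → 2 ℕ.* a ℕ.* (2 ℕ.* a) ℕ.+ 4 ℕ.* S ≡ 4 ℕ.* (a ℕ.* a ℕ.+ S)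
  step = ℕRing.solve-∀

tight-sum : ∀ {a b M N} → a ℕ.≤ M → b ℕ.≤ N → a ℕ.+ b ≡ M ℕ.+ N → a ≡ M × b ≡ N
tight-sum {a} {b} {M} {N} a≤M b≤N eq = a≡M , ℕP.+-cancelˡ-≡ M b N (trans (cong (ℕ._+ b) (sym a≡M)) eq)
  where
  a≡M : a ≡ M
  a≡M = ℕP.≤-antisym a≤M (ℕP.+-cancelʳ-≤ N M a
          (ℕP.≤-trans (ℕP.≤-reflexive (sym eq)) (ℕP.+-monoʳ-≤ a b≤N)))

sumSqℕ-bound : ∀ {k m} (v : Vec ℤ k) → Bounded m v → sumSqℕ v ℕ.≤ k ℕ.* (m ℕ.* m)
sumSqℕ-bound []      []         = z≤n
sumSqℕ-bound (a ∷ v) (a≤m ∷ vs) = ℕP.+-mono-≤ (ℕP.*-mono-≤ a≤m a≤m) (sumSqℕ-bound v vs)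

sumSqℕ-tight : ∀ {k m} (v : Vec ℤ k) → Bounded m v →
  sumSqℕ v ≡ k ℕ.* (m ℕ.* m) → All (λ a → ∣ a ∣ ≡ m) v
sumSqℕ-tight []      []         _  = []
sumSqℕ-tight (a ∷ v) (a≤m ∷ vs) eq with tight-sum (ℕP.*-mono-≤ a≤m a≤m) (sumSqℕ-bound v vs) eq
... | a²≡m² , rest = square-injective a²≡m² ∷ sumSqℕ-tight v vs rest
  where
  square-injective : ∀ {x y} → x ℕ.* x ≡ y ℕ.* y → x ≡ y
  square-injective {x} {y} e with ℕP.<-cmp x y
  ... | tri< x<y _ _ = ⊥-elim (ℕP.<-irrefl e (ℕP.*-mono-< x<y x<y))
  ... | tri≈ _ x≡y _ = x≡y
  ... | tri> _ _ y<x = ⊥-elim (ℕP.<-irrefl (sym e) (ℕP.*-mono-< y<x y<x))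

sumSqℕ-zero : ∀ {k} (v : Vec ℤ k) → sumSqℕ v ≡ 0 → All (λ a → ∣ a ∣ ≡ 0) v
sumSqℕ-zero []      _  = []
sumSqℕ-zero (a ∷ v) eq =
  [ id , id ]′ (ℕP.m*n≡0⇒m≡0∨n≡0 ∣ a ∣ (ℕP.m+n≡0⇒m≡0 (∣ a ∣ ℕ.* ∣ a ∣) eq))
  ∷ sumSqℕ-zero v (ℕP.m+n≡0⇒n≡0 (∣ a ∣ ℕ.* ∣ a ∣) eq)

centredResidue : ∀ m .{{_ : ℕ.NonZero m}} x →
  Σ ℤ λ y → Σ ℤ λ q → x ≡ y + + m * q × ∣ + 2 * y ∣ ℕ.≤ m
centredResidue m x = centre (x %ℕ m) (x /ℕ m) (a≡a%ℕn+[a/ℕn]*n x m) (n%ℕd<d x m)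
  where
  centre : ∀ r q → x ≡ + r + q * + m → r ℕ.< m →
           Σ ℤ λ y → Σ ℤ λ q → x ≡ y + + m * q × ∣ + 2 * y ∣ ℕ.≤ m
  centre r q eq r<m with 2 ℕ.* r ℕ.≤? m
  ... | yes 2r≤m = + r , q , trans eq (cong (λ t → + r + t) (ℤP.*-comm q (+ m))) ,
                   subst (ℕ._≤ m) (sym (ℤP.abs-* (+ 2) (+ r))) 2r≤m
  ... | no 2r≰m = - + s , q + + 1 , trans eq (trans (cong (λ M → + r + q * M) m≡s+r)
                   (trans (rearrange (+ r) (+ s) q) (cong (λ M → - + s + M * (q + + 1)) (sym m≡s+r)))) ,
                  subst (ℕ._≤ m) (sym (trans (ℤP.abs-* (+ 2) (- + s)) (cong (2 ℕ.*_) (ℤP.∣-i∣≡∣i∣ (+ s))))) 2s≤m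
    where
    s : ℕ
    s = m ℕ.∸ r
    s+r≡m : s ℕ.+ r ≡ m
    s+r≡m = ℕP.m∸n+n≡m (ℕP.<⇒≤ r<m)
    m≡s+r : + m ≡ + s + + r
    m≡s+r = trans (cong +_ (sym s+r≡m)) (ℤP.pos-+ s r)
    rearrange : ∀ r s q → r + q * (s + r) ≡ - s + (s + r) * (q + + 1)
    rearrange = solve-∀
    2s≤m : 2 ℕ.* s ℕ.≤ m
    2s≤m = ℕP.+-cancelʳ-≤ (2 ℕ.* r) (2 ℕ.* s) m (begin
      2 ℕ.* s ℕ.+ 2 ℕ.* r ≡⟨ sym (ℕP.*-distribˡ-+ 2 s r) ⟩
      2 ℕ.* (s ℕ.+ r)     ≡⟨ cong (2 ℕ.*_) s+r≡m ⟩
      2 ℕ.* m             ≡⟨ cong (m ℕ.+_) (ℕP.+-identityʳ m) ⟩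
      m ℕ.+ m             ≤⟨ ℕP.+-monoʳ-≤ m (ℕP.<⇒≤ (ℕP.≰⇒> 2r≰m)) ⟩
      m ℕ.+ 2 ℕ.* r       ∎)
      where open ℕP.≤-Reasoning

centredResidues : ∀ {k} m .{{_ : ℕ.NonZero m}} (x : Vec ℤ k) →
  Σ (Vec ℤ k) λ y → Σ (Vec ℤ k) λ q → x ≡ shift (+ m) y q × Bounded m (double y)
centredResidues m []      = [] , [] , refl , []
centredResidues m (a ∷ x) with centredResidue m a | centredResidues m x
... | b , c , refl , small | y , q , refl , smalls = b ∷ y , c ∷ q , refl , small ∷ smalls

sumSq-scale : ∀ {k} m (z : Vec ℤ k) → sumSq (map (m *_) z) ≡ m * (m * sumSq z)
sumSq-scale m []      = sym (trans (cong (m *_) (ℤP.*-zeroʳ m)) (ℤP.*-zeroʳ m))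
sumSq-scale m (a ∷ z) = trans (cong (λ S → m * a * (m * a) + S) (sumSq-scale m z)) (expand m a (sumSq z))
  where
  expand : ∀ m a S → m * a * (m * a) + m * (m * S) ≡ m * (m * (a * a + S))
  expand = solve-∀

-- Descent via Euler's identity: if v ≡ u (mod m) componentwise with |u|² = m P and
-- |v|² = m R, then every entry of the Euler product of v and u is divisible by m,
-- and dividing it by m exhibits R P as a sum of four squares.
congruent-product : ∀ m .{{_ : ℤ.NonZero m}} (v q : Vec ℤ 4) P R →
  sumSq (shift m v q) ≡ m * P → sumSq v ≡ m * R → FourSquares (R * P)
congruent-product m v@(v₁ ∷ v₂ ∷ v₃ ∷ v₄ ∷ []) q@(q₁ ∷ q₂ ∷ q₃ ∷ q₄ ∷ []) P R hu hv =
  z , ℤP.*-cancelˡ-≡ m _ _ (ℤP.*-cancelˡ-≡ m _ _ (begin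
    m * (m * sumSq z)                       ≡⟨ sym (sumSq-scale m z) ⟩
    sumSq (map (m *_) z)                    ≡⟨ cong sumSq (sym euler-divisible) ⟩
    sumSq (eulerProduct v (shift m v q))    ≡⟨ sym (sumSq-eulerProduct v (shift m v q)) ⟩
    sumSq v * sumSq (shift m v q)           ≡⟨ cong₂ _*_ hv hu ⟩
    m * R * (m * P)                         ≡⟨ regroup m R P ⟩
    m * (m * (R * P))                       ∎))
  where
  open ≡-Reasoning
  z : Vec ℤ 4
  z = R + (v₁ * q₁ + v₂ * q₂ + v₃ * q₃ + v₄ * q₄) ∷ v₁ * q₂ - v₂ * q₁ + v₃ * q₄ - v₄ * q₃ ∷
      v₁ * q₃ - v₂ * q₄ - v₃ * q₁ + v₄ * q₂ ∷ v₁ * q₄ + v₂ * q₃ - v₃ * q₂ - v₄ * q₁ ∷ []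
  regroup : ∀ m R P → m * R * (m * P) ≡ m * (m * (R * P))
  regroup = solve-∀
  first : ∀ m a b c d x y z w → a * (a + m * x) + b * (b + m * y) + c * (c + m * z) + d * (d + m * w)
          ≡ (a * a + (b * b + (c * c + (d * d + + 0)))) + m * (a * x + b * y + c * z + d * w)
  first = solve-∀
  second : ∀ m a b c d x y z w → a * (b + m * y) - b * (a + m * x) + c * (d + m * w) - d * (c + m * z)
           ≡ m * (a * y - b * x + c * w - d * z)
  second = solve-∀
  third : ∀ m a b c d x y z w → a * (c + m * z) - b * (d + m * w) - c * (a + m * x) + d * (b + m * y)
          ≡ m * (a * z - b * w - c * x + d * y)
  third = solve-∀
  fourth : ∀ m a b c d x y z w → a * (d + m * w) + b * (c + m * z) - c * (b + m * y) - d * (a + m * x)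
           ≡ m * (a * w + b * z - c * y - d * x)
  fourth = solve-∀
  euler-divisible : eulerProduct v (shift m v q) ≡ map (m *_) z
  euler-divisible = cong₂ _∷_
    (trans (first m v₁ v₂ v₃ v₄ q₁ q₂ q₃ q₄)
           (trans (cong (_+ _) hv) (sym (ℤP.*-distribˡ-+ m R _))))
    (cong₂ _∷_ (second m v₁ v₂ v₃ v₄ q₁ q₂ q₃ q₄)
    (cong₂ _∷_ (third m v₁ v₂ v₃ v₄ q₁ q₂ q₃ q₄)
    (cong₂ _∷_ (fourth m v₁ v₂ v₃ v₄ q₁ q₂ q₃ q₄) refl)))

residue-sum : ∀ {k} m p (y q : Vec ℤ k) → sumSq (shift m y q) ≡ m * p →
  sumSq y ≡ m * (p - (dot (double y) q + m * sumSq q))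
residue-sum m p y q hx = begin
  sumSq y                 ≡⟨ add-subtract (sumSq y) (m * T) ⟩
  sumSq y + m * T - m * T ≡⟨ cong (_- m * T) (trans (sym (sumSq-shift m y q)) hx) ⟩
  m * p - m * T           ≡⟨ factor m p T ⟩
  m * (p - T)             ∎
  where
  open ≡-Reasoning
  T : ℤ
  T = dot (double y) q + m * sumSq q
  add-subtract : ∀ S U → S ≡ S + U - U
  add-subtract = solve-∀
  factor : ∀ m p T → m * p - m * T ≡ m * (p - T)
  factor = solve-∀

nonneg-cofactor : ∀ m {R n} → + suc m * R ≡ + n → Σ ℕ λ r → R ≡ + r
nonneg-cofactor m {+ r}      _ = r , refl
nonneg-cofactor m { -[1+ _ ]} ()

dot-divisible : ∀ {k m} (w q : Vec ℤ k) → All (m ∣_) w → m ∣ dot w q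
dot-divisible []      []      []         = ℤ∣.divides (+ 0) refl
dot-divisible (a ∷ w) (b ∷ q) (m∣a ∷ ms) = ∣m∣n⇒∣m+n (∣m⇒∣m*n b m∣a) (dot-divisible w q ms)

abs-divisible : ∀ {m c a} → m ℕ∣.∣ c → ∣ a ∣ ≡ c → + m ∣ a
abs-divisible m∣c refl = ∣ᵤ⇒∣ m∣c

trichotomy : ∀ {r m} → r ℕ.≤ m → r ≡ 0 ⊎ r ≡ m ⊎ (0 ℕ.< r × r ℕ.< m)
trichotomy {zero}  _   = inj₁ refl
trichotomy {suc r} r≤m with ℕP.m≤n⇒m<n∨m≡n r≤m
... | inj₁ r<m = inj₂ (inj₂ (z<s , r<m))
... | inj₂ r≡m = inj₂ (inj₁ r≡m)

-- Fermat's descent for a prime p: a representation of m p as a sum of four squares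
-- with 1 < m < p yields one of r p with 0 < r < m.
module Descent {p : ℕ} (p-prime : Prime p) where

  no-proper-divisor : ∀ {m} → 1 ℕ.< m → m ℕ.< p → ¬ (+ m ∣ + p)
  no-proper-divisor {m} 1<m m<p m∣p = Prime.notComposite p-prime (composite m<p (∣⇒∣ᵤ m∣p))
    where instance _ = ℕ.n>1⇒nonTrivial 1<m

  -- The descent step on the centred residues y of a representation x = y + m q
  -- of m p: their sum of squares is m r with 0 ≤ r ≤ m; the extreme cases r = 0 and
  -- r = m make every 2yᵢ divisible by m and hence m divide p, otherwise
  -- congruent-product represents r p.
  descent-on-residues : ∀ {m} → 1 ℕ.< m → m ℕ.< p → (y q : Vec ℤ 4) →
    Bounded m (double y) → sumSq (shift (+ m) y q) ≡ + m * + p →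
    Σ ℕ λ r → 0 ℕ.< r × r ℕ.< m × FourSquares (+ r * + p)
  descent-on-residues {m} 1<m@(s≤s (s≤s _)) m<p y q small hx = result (trichotomy r≤m)
    where
    M T R : ℤ
    M = + m
    T = dot (double y) q + M * sumSq q
    R = + p - T
    Y : ℕ
    Y = sumSqℕ y
    Σy≡mR : sumSq y ≡ M * R
    Σy≡mR = residue-sum M (+ p) y q hx
    mR≡Y : M * R ≡ + Y
    mR≡Y = trans (sym Σy≡mR) (sumSq≡sumSqℕ y)
    r : ℕ
    r = proj₁ (nonneg-cofactor (ℕ.pred m) mR≡Y)
    R≡r : R ≡ + r
    R≡r = proj₂ (nonneg-cofactor (ℕ.pred m) mR≡Y)
    mr≡Y : m ℕ.* r ≡ Y
    mr≡Y = ℤP.+-injective (trans (ℤP.pos-* m r) (trans (cong (M *_) (sym R≡r)) mR≡Y))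
    4Y≡sum : 4 ℕ.* (m ℕ.* r) ≡ sumSqℕ (double y)
    4Y≡sum = trans (cong (4 ℕ.*_) mr≡Y) (sym (sumSqℕ-double y))
    r≤m : r ℕ.≤ m
    r≤m = ℕP.*-cancelˡ-≤ m (ℕP.*-cancelˡ-≤ 4
            (ℕP.≤-trans (ℕP.≤-reflexive 4Y≡sum) (sumSqℕ-bound (double y) small)))
    p-divisible : All (M ∣_) (double y) → M ∣ R → M ∣ + p
    p-divisible ms m∣R = subst (M ∣_) (split (+ p) T)
      (∣m∣n⇒∣m+n m∣R (∣m∣n⇒∣m+n (dot-divisible (double y) q ms) (∣m⇒∣m*n (sumSq q) ℤ∣.∣-refl)))
      where
      split : ∀ P T → P - T + T ≡ P
      split = solve-∀
    extreme⇒⊥ : All (M ∣_) (double y) → M ∣ R → ⊥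
    extreme⇒⊥ ms m∣R = no-proper-divisor 1<m m<p (p-divisible ms m∣R)
    result : r ≡ 0 ⊎ r ≡ m ⊎ (0 ℕ.< r × r ℕ.< m) →
             Σ ℕ λ r → 0 ℕ.< r × r ℕ.< m × FourSquares (+ r * + p)
    result (inj₁ r≡0) = ⊥-elim (extreme⇒⊥
      (All.map (abs-divisible (m ∣0)) (sumSqℕ-zero (double y)
        (trans (sym 4Y≡sum) (trans (cong (λ r → 4 ℕ.* (m ℕ.* r)) r≡0) (cong (4 ℕ.*_) (ℕP.*-zeroʳ m))))))
      (ℤ∣.divides (+ 0) (trans R≡r (cong +_ r≡0))))
    result (inj₂ (inj₁ r≡m)) = ⊥-elim (extreme⇒⊥
      (All.map (abs-divisible ℕ∣.∣-refl) (sumSqℕ-tight (double y) small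
        (trans (sym 4Y≡sum) (cong (λ r → 4 ℕ.* (m ℕ.* r)) r≡m))))
      (ℤ∣.∣-reflexive (sym (trans R≡r (cong +_ r≡m)))))
    result (inj₂ (inj₂ (0<r , r<m))) =
      r , 0<r , r<m , subst (λ R → FourSquares (R * + p)) R≡r (congruent-product M y q (+ p) R hx Σy≡mR)

  descent-step : ∀ {m} → 1 ℕ.< m → m ℕ.< p → FourSquares (+ m * + p) →
    Σ ℕ λ r → 0 ℕ.< r × r ℕ.< m × FourSquares (+ r * + p)
  descent-step {m@(suc _)} 1<m m<p (x , hx) with centredResidues m x
  ... | y , q , refl , small = descent-on-residues 1<m m<p y q small hx

equal-residues : ∀ p .{{_ : ℕ.NonZero p}} x y → x %ℕ p ≡ y %ℕ p → + p ∣ x - y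
equal-residues p x y same = ℤ∣.divides (x /ℕ p - y /ℕ p) (begin
  x - y                                                   ≡⟨ cong₂ _-_ (a≡a%ℕn+[a/ℕn]*n x p) (a≡a%ℕn+[a/ℕn]*n y p) ⟩
  + (x %ℕ p) + x /ℕ p * + p - (+ (y %ℕ p) + y /ℕ p * + p) ≡⟨ cong (λ r → + (x %ℕ p) + x /ℕ p * + p - (+ r + y /ℕ p * + p)) (sym same) ⟩
  + (x %ℕ p) + x /ℕ p * + p - (+ (x %ℕ p) + y /ℕ p * + p) ≡⟨ cancel (+ (x %ℕ p)) (x /ℕ p) (y /ℕ p) (+ p) ⟩
  (x /ℕ p - y /ℕ p) * + p                                 ∎)
  where
  open ≡-Reasoning
  cancel : ∀ r a b p → r + a * p - (r + b * p) ≡ (a - b) * p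
  cancel = solve-∀

sumOfTwoSquaresPlusOne : ∀ a b → + (a ℕ.* a ℕ.+ b ℕ.* b ℕ.+ 1) ≡ + a * + a + + b * + b + + 1
sumOfTwoSquaresPlusOne a b =
  trans (ℤP.pos-+ (a ℕ.* a ℕ.+ b ℕ.* b) 1)
        (cong (_+ + 1) (trans (ℤP.pos-+ (a ℕ.* a) (b ℕ.* b)) (cong₂ _+_ (ℤP.pos-* a a) (ℤP.pos-* b b))))

-- For a prime p there are a, b ≤ p/2 with p ∣ a² + b² + 1: the k + 1 values a²
-- and the k + 1 values −(1 + b²) (k = p/2) are pairwise incongruent within each
-- family, so by the pigeonhole principle two from different families collide.
module SquaresModuloPrime {p : ℕ} (p-prime : Prime p) where

  instance
    p≢0 : ℕ.NonZero p
    p≢0 = prime⇒nonZero p-prime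

  k : ℕ
  k = p ℕ./ 2

  k+k≤p : k ℕ.+ k ℕ.≤ p
  k+k≤p = subst (ℕ._≤ p) (twice k) (m/n*n≤m p 2)
    where
    twice : ∀ k → k ℕ.* 2 ≡ k ℕ.+ k
    twice = ℕRing.solve-∀

  p<2k+2 : p ℕ.< suc k ℕ.+ suc k
  p<2k+2 = begin-strict
    p                        ≡⟨ m≡m%n+[m/n]*n p 2 ⟩
    p ℕ.% 2 ℕ.+ k ℕ.* 2      <⟨ ℕP.+-monoˡ-< (k ℕ.* 2) (m%n<n p 2) ⟩
    2 ℕ.+ k ℕ.* 2            ≡⟨ twice k ⟩
    suc k ℕ.+ suc k          ∎
    where
    open ℕP.≤-Reasoning
    twice : ∀ k → 2 ℕ.+ k ℕ.* 2 ≡ suc k ℕ.+ suc k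
    twice = ℕRing.solve-∀

  0<k : 0 ℕ.< k
  0<k = positive k (ℕ.nonTrivial⇒n>1 p {{prime⇒nonTrivial p-prime}}) p<2k+2
    where
    positive : ∀ k → 1 ℕ.< p → p ℕ.< suc k ℕ.+ suc k → 0 ℕ.< k
    positive zero    (s≤s (s≤s _)) (s≤s (s≤s ()))
    positive (suc k) _ _ = z<s

  k<p : k ℕ.< p
  k<p = ℕP.<-≤-trans (ℕP.m<m+n k 0<k) k+k≤p

  -- p ∤ a² − b² for b < a ≤ k: a² − b² = (a − b)(a + b) and 0 < a − b ≤ k < p, 0 < a + b < p.
  ordered-squares : ∀ {a b} → b ℕ.< a → a ℕ.≤ k → ¬ (+ p ∣ + a * + a - + b * + b)
  ordered-squares {a} {b} b<a a≤k p∣ with ℕP.m≤n⇒∃[o]m+o≡n (ℕP.<⇒≤ b<a)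
  ... | d , refl = [ difference , sum ]′ (euclidsLemma d (b ℕ.+ d ℕ.+ b) p-prime
                     (subst (p ℕ∣.∣_) (cong ∣_∣ difference-as-product) (∣⇒∣ᵤ p∣)))
    where
    open ≡-Reasoning
    difference-as-product : + (b ℕ.+ d) * + (b ℕ.+ d) - + b * + b ≡ + (d ℕ.* (b ℕ.+ d ℕ.+ b))
    difference-as-product = begin
      + (b ℕ.+ d) * + (b ℕ.+ d) - + b * + b   ≡⟨ cong (λ a → a * a - + b * + b) (ℤP.pos-+ b d) ⟩
      (+ b + + d) * (+ b + + d) - + b * + b   ≡⟨ difference-of-squares (+ b) (+ d) ⟩
      + d * (+ b + + d + + b)                 ≡⟨ cong (+ d *_) (sym (trans (ℤP.pos-+ (b ℕ.+ d) b) (cong (_+ + b) (ℤP.pos-+ b d)))) ⟩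
      + d * + (b ℕ.+ d ℕ.+ b)                 ≡⟨ sym (ℤP.pos-* d (b ℕ.+ d ℕ.+ b)) ⟩
      + (d ℕ.* (b ℕ.+ d ℕ.+ b))               ∎
      where
      difference-of-squares : ∀ b d → (b + d) * (b + d) - b * b ≡ d * (b + d + b)
      difference-of-squares = solve-∀
    0<d : 0 ℕ.< d
    0<d = ℕP.+-cancelˡ-< b 0 d (subst (ℕ._< b ℕ.+ d) (sym (ℕP.+-identityʳ b)) b<a)
    difference : ¬ (p ℕ∣.∣ d)
    difference = >⇒∤ {{ℕ.>-nonZero 0<d}}
                     (ℕP.≤-<-trans (ℕP.≤-trans (ℕP.m≤n+m d b) a≤k) k<p)
    sum : ¬ (p ℕ∣.∣ b ℕ.+ d ℕ.+ b)
    sum = >⇒∤ {{ℕ.>-nonZero (ℕP.<-≤-trans 0<d (ℕP.≤-trans (ℕP.m≤n+m d b) (ℕP.m≤m+n (b ℕ.+ d) b)))}}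
            (ℕP.<-≤-trans (ℕP.+-monoʳ-< (b ℕ.+ d) b<a) (ℕP.≤-trans (ℕP.+-mono-≤ a≤k a≤k) k+k≤p))

  distinct-squares : ∀ {a b} → a ≢ b → a ℕ.≤ k → b ℕ.≤ k → ¬ (+ p ∣ + a * + a - + b * + b)
  distinct-squares {a} {b} a≢b a≤k b≤k p∣ with ℕP.<-cmp a b
  ... | tri< a<b _ _ = ordered-squares a<b b≤k (subst (+ p ∣_) (negate (+ a) (+ b)) (∣m⇒∣-m p∣))
    where
    negate : ∀ a b → - (a * a - b * b) ≡ b * b - a * a
    negate = solve-∀
  ... | tri≈ _ a≡b _ = a≢b a≡b
  ... | tri> _ _ b<a = ordered-squares b<a a≤k p∣

  value : Fin (suc k) ⊎ Fin (suc k) → ℤ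
  value (inj₁ a) = + toℕ a * + toℕ a
  value (inj₂ b) = - (+ 1 + + toℕ b * + toℕ b)

  TwoSquaresPlusOne : Set
  TwoSquaresPlusOne = Σ ℕ λ a → Σ ℕ λ b → a ℕ.≤ k × b ℕ.≤ k × p ℕ∣.∣ a ℕ.* a ℕ.+ b ℕ.* b ℕ.+ 1

  bound : (a : Fin (suc k)) → toℕ a ℕ.≤ k
  bound a = ℕP.≤-pred (FinP.toℕ<n a)

  divides-sum : ∀ {a b} → + p ∣ + a * + a + + b * + b + + 1 → p ℕ∣.∣ a ℕ.* a ℕ.+ b ℕ.* b ℕ.+ 1
  divides-sum {a} {b} p∣ = subst (p ℕ∣.∣_) (cong ∣_∣ (sym (sumOfTwoSquaresPlusOne a b))) (∣⇒∣ᵤ p∣)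

  collision : ∀ s t → s ≢ t → + p ∣ value s - value t → TwoSquaresPlusOne
  collision (inj₁ a) (inj₁ b) s≢t p∣ =
    ⊥-elim (distinct-squares (s≢t ∘ cong inj₁ ∘ FinP.toℕ-injective) (bound a) (bound b) p∣)
  collision (inj₂ a) (inj₂ b) s≢t p∣ =
    ⊥-elim (distinct-squares (s≢t ∘ cong inj₂ ∘ FinP.toℕ-injective ∘ sym) (bound b) (bound a)
      (subst (+ p ∣_) (rearrange (+ toℕ a) (+ toℕ b)) p∣))
    where
    rearrange : ∀ a b → - (+ 1 + a * a) - - (+ 1 + b * b) ≡ b * b - a * a
    rearrange = solve-∀
  collision (inj₁ a) (inj₂ b) _ p∣ = toℕ a , toℕ b , bound a , bound b ,
    divides-sum {toℕ a} {toℕ b} (subst (+ p ∣_) (rearrange (+ toℕ a) (+ toℕ b)) p∣)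
    where
    rearrange : ∀ a b → a * a - - (+ 1 + b * b) ≡ a * a + b * b + + 1
    rearrange = solve-∀
  collision (inj₂ a) (inj₁ b) _ p∣ = toℕ b , toℕ a , bound b , bound a ,
    divides-sum {toℕ b} {toℕ a} (subst (+ p ∣_) (rearrange (+ toℕ a) (+ toℕ b)) (∣m⇒∣-m p∣))
    where
    rearrange : ∀ a b → - (- (+ 1 + a * a) - b * b) ≡ b * b + a * a + + 1
    rearrange = solve-∀

  residue : Fin (suc k ℕ.+ suc k) → Fin p
  residue i = fromℕ< (n%ℕd<d (value (Fin.splitAt (suc k) i)) p)

  two-squares-plus-one : TwoSquaresPlusOne
  two-squares-plus-one with FinP.pigeonhole p<2k+2 residue
  ... | i , j , i<j , same = collision (Fin.splitAt (suc k) i) (Fin.splitAt (suc k) j) distinct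
    (equal-residues p (value (Fin.splitAt (suc k) i)) (value (Fin.splitAt (suc k) j))
      (trans (sym (FinP.toℕ-fromℕ< _)) (trans (cong toℕ same) (FinP.toℕ-fromℕ< _))))
    where
    distinct : Fin.splitAt (suc k) i ≢ Fin.splitAt (suc k) j
    distinct e = FinP.<⇒≢ i<j (trans (sym (FinP.join-splitAt (suc k) (suc k) i))
                                 (trans (cong (Fin.join (suc k) (suc k)) e) (FinP.join-splitAt (suc k) (suc k) j)))

  multiple-from : TwoSquaresPlusOne → Σ ℕ λ m → 0 ℕ.< m × m ℕ.< p × FourSquares (+ m * + p)
  multiple-from (a , b , a≤k , b≤k , divides m eq) =
    m , positive-factor m (subst (0 ℕ.<_) eq (subst (0 ℕ.<_) (ℕP.+-comm 1 _) z<s)) ,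
    ℕP.*-cancelʳ-< p m p (subst (ℕ._< p ℕ.* p) eq below-p²) ,
    (+ a ∷ + b ∷ + 1 ∷ + 0 ∷ []) , representation
    where
    positive-factor : ∀ m → 0 ℕ.< m ℕ.* p → 0 ℕ.< m
    positive-factor (suc _) _ = z<s
    below-p² : a ℕ.* a ℕ.+ b ℕ.* b ℕ.+ 1 ℕ.< p ℕ.* p
    below-p² = begin-strict
      a ℕ.* a ℕ.+ b ℕ.* b ℕ.+ 1                 ≤⟨ ℕP.+-monoˡ-≤ 1 (ℕP.+-mono-≤ (ℕP.*-mono-≤ a≤k a≤k) (ℕP.*-mono-≤ b≤k b≤k)) ⟩
      k ℕ.* k ℕ.+ k ℕ.* k ℕ.+ 1                 <⟨ ℕP.+-monoʳ-< (k ℕ.* k ℕ.+ k ℕ.* k) (ℕP.+-mono-≤ 1≤k² 1≤k²) ⟩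
      k ℕ.* k ℕ.+ k ℕ.* k ℕ.+ (k ℕ.* k ℕ.+ k ℕ.* k) ≡⟨ square-of-double k ⟩
      (k ℕ.+ k) ℕ.* (k ℕ.+ k)                   ≤⟨ ℕP.*-mono-≤ k+k≤p k+k≤p ⟩
      p ℕ.* p                                   ∎
      where
      open ℕP.≤-Reasoning
      1≤k² : 1 ℕ.≤ k ℕ.* k
      1≤k² = ℕP.*-mono-≤ 0<k 0<k
      square-of-double : ∀ k → k ℕ.* k ℕ.+ k ℕ.* k ℕ.+ (k ℕ.* k ℕ.+ k ℕ.* k) ≡ (k ℕ.+ k) ℕ.* (k ℕ.+ k)
      square-of-double = ℕRing.solve-∀
    representation : + a * + a + (+ b * + b + (+ 1 * + 1 + (+ 0 * + 0 + + 0))) ≡ + m * + p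
    representation = begin
      + a * + a + (+ b * + b + (+ 1 * + 1 + (+ 0 * + 0 + + 0))) ≡⟨ normalise (+ a) (+ b) ⟩
      + a * + a + + b * + b + + 1                                ≡⟨ sym (sumOfTwoSquaresPlusOne a b) ⟩
      + (a ℕ.* a ℕ.+ b ℕ.* b ℕ.+ 1)                              ≡⟨ cong +_ eq ⟩
      + (m ℕ.* p)                                                ≡⟨ ℤP.pos-* m p ⟩
      + m * + p                                                  ∎
      where
      open ≡-Reasoning
      normalise : ∀ a b → a * a + (b * b + (+ 1 * + 1 + (+ 0 * + 0 + + 0))) ≡ a * a + b * b + + 1
      normalise = solve-∀

  initial-multiple : Σ ℕ λ m → 0 ℕ.< m × m ℕ.< p × FourSquares (+ m * + p)
  initial-multiple = multiple-from two-squares-plus-one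

prime-fourSquares : ∀ {p} → Prime p → FourSquares (+ p)
prime-fourSquares {p} p-prime = descend-from (SquaresModuloPrime.initial-multiple p-prime)
  where
  open Descent p-prime
  Descends : ℕ → Set
  Descends m = 0 ℕ.< m → m ℕ.< p → FourSquares (+ m * + p) → FourSquares (+ p)
  descend : ∀ m → (∀ {r} → r ℕ.< m → Descends r) → Descends m
  descend 1                  _  _ _   fs = subst FourSquares (ℤP.*-identityˡ (+ p)) fs
  descend m@(suc (suc _)) smaller _ m<p fs with descent-step (s≤s (s≤s z≤n)) m<p fs
  ... | r , 0<r , r<m , fs′ = smaller r<m 0<r (ℕP.<-trans r<m m<p) fs′
  descend-from : (Σ ℕ λ m → 0 ℕ.< m × m ℕ.< p × FourSquares (+ m * + p)) → FourSquares (+ p)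
  descend-from (m , 0<m , m<p , fs) = <-rec Descends descend m 0<m m<p fs

productOfPrimes-fourSquares : ∀ {ps} → ListAll.All Prime ps → FourSquares (+ product ps)
productOfPrimes-fourSquares ListAll.[]                        = (+ 1 ∷ + 0 ∷ + 0 ∷ + 0 ∷ []) , refl
productOfPrimes-fourSquares {p List.∷ ps} (p-prime ListAll.∷ primes) =
  subst FourSquares (sym (ℤP.pos-* p (product ps)))
    (fourSquares-* (prime-fourSquares p-prime) (productOfPrimes-fourSquares primes))

lagrange : ∀ n → FourSquares (+ n)
lagrange zero       = (+ 0 ∷ + 0 ∷ + 0 ∷ + 0 ∷ []) , refl
lagrange n@(suc _)  = subst (FourSquares ∘ +_) (sym isFactorisation) (productOfPrimes-fourSquares factorsPrime)
  where open PrimeFactorisation (factorise n)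

rename : ∀ {n m} → (Fin n → Fin m) → Poly n → Poly m
rename ρ (const c) = const c
rename ρ (var i)   = var (ρ i)
rename ρ (p ⊕ q)   = rename ρ p ⊕ rename ρ q
rename ρ (p ⊗ q)   = rename ρ p ⊗ rename ρ q

eval-rename : ∀ {n m} (ρ : Fin n → Fin m) p (z : Vec ℤ m) →
  eval (rename ρ p) z ≡ eval p (tabulate (lookup z ∘ ρ))
eval-rename ρ (const c) z = refl
eval-rename ρ (var i)   z = sym (VecP.lookup∘tabulate (lookup z ∘ ρ) i)
eval-rename ρ (p ⊕ q)   z = cong₂ _+_ (eval-rename ρ p z) (eval-rename ρ q z)
eval-rename ρ (p ⊗ q)   z = cong₂ _*_ (eval-rename ρ p z) (eval-rename ρ q z)

sumSqPoly : ∀ {k m} → (Fin k → Fin m) → Poly m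
sumSqPoly {zero}  ι = const (+ 0)
sumSqPoly {suc k} ι = (var (ι Fin.zero) ⊗ var (ι Fin.zero)) ⊕ sumSqPoly (ι ∘ Fin.suc)

eval-sumSqPoly : ∀ {k m} (ι : Fin k → Fin m) (z : Vec ℤ m) →
  eval (sumSqPoly ι) z ≡ sumSq (tabulate (lookup z ∘ ι))
eval-sumSqPoly {zero}  ι z = refl
eval-sumSqPoly {suc k} ι z = cong (λ s → lookup z (ι Fin.zero) * lookup z (ι Fin.zero) + s) (eval-sumSqPoly (ι ∘ Fin.suc) z)

left-block : ∀ {n k} (x : Vec ℤ n) (y : Vec ℤ k) → tabulate (lookup (x ++ y) ∘ (_↑ˡ k)) ≡ x
left-block x y = trans (VecP.tabulate-cong (VecP.lookup-++ˡ x y)) (VecP.tabulate∘lookup x)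

right-block : ∀ {n k} (x : Vec ℤ n) (y : Vec ℤ k) → tabulate (lookup (x ++ y) ∘ (n ↑ʳ_)) ≡ y
right-block x y = trans (VecP.tabulate-cong (VecP.lookup-++ʳ x y)) (VecP.tabulate∘lookup y)

auxiliary : ∀ {n} → Poly n → Poly (n ℕ.+ 8)
auxiliary {n} D = (D′ ⊗ D′) ⊕ (E ⊗ E)
  where
  D′ E : Poly (n ℕ.+ 8)
  D′ = rename (_↑ˡ 8) D
  E  = sumSqPoly (n ↑ʳ_) ⊕ (const -[1+ 0 ] ⊗ sumSqPoly (_↑ˡ 8))

eval-auxiliary : ∀ {n} (D : Poly n) (x : Vec ℤ n) (y : Vec ℤ 8) →
  eval (auxiliary D) (x ++ y) ≡ eval D x * eval D x + (sumSq y - sumSq x) * (sumSq y - sumSq x)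
eval-auxiliary {n} D x y = cong₂ (λ d e → d * d + e * e) eval-D eval-E
  where
  eval-D : eval (rename (_↑ˡ 8) D) (x ++ y) ≡ eval D x
  eval-D = trans (eval-rename (_↑ˡ 8) D (x ++ y)) (cong (eval D) (left-block x y))
  eval-E : eval (sumSqPoly (n ↑ʳ_)) (x ++ y) + -[1+ 0 ] * eval (sumSqPoly (_↑ˡ 8)) (x ++ y) ≡ sumSq y - sumSq x
  eval-E = trans (cong₂ (λ s t → s + -[1+ 0 ] * t)
                   (trans (eval-sumSqPoly (n ↑ʳ_) (x ++ y)) (cong sumSq (right-block x y)))
                   (trans (eval-sumSqPoly (_↑ˡ 8) (x ++ y)) (cong sumSq (left-block x y))))
                 (minus (sumSq y) (sumSq x))
    where
    minus : ∀ s t → s + -[1+ 0 ] * t ≡ s - t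
    minus = solve-∀

squares-vanish : ∀ a b → a * a + b * b ≡ + 0 → a ≡ + 0 × b ≡ + 0
squares-vanish a b e with sumSqℕ-zero (a ∷ b ∷ [])
                            (ℤP.+-injective (trans (sym (sumSq≡sumSqℕ (a ∷ b ∷ []))) (trans (cong (λ s → a * a + s) (ℤP.+-identityʳ (b * b))) e)))
... | ∣a∣≡0 ∷ ∣b∣≡0 ∷ [] = ℤP.∣i∣≡0⇒i≡0 ∣a∣≡0 , ℤP.∣i∣≡0⇒i≡0 ∣b∣≡0

auxiliary-sound : ∀ {n} (D : Poly n) x y → IsSolution (auxiliary D) (x ++ y) →
  IsSolution D x × sumSq y ≡ sumSq x
auxiliary-sound D x y sol with squares-vanish (eval D x) (sumSq y - sumSq x) (trans (sym (eval-auxiliary D x y)) sol)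
... | Dx≡0 , e≡0 = Dx≡0 , ℤP.i-j≡0⇒i≡j (sumSq y) (sumSq x) e≡0

auxiliary-complete : ∀ {n} (D : Poly n) x y → IsSolution D x → sumSq y ≡ sumSq x →
  IsSolution (auxiliary D) (x ++ y)
auxiliary-complete D x y Dx≡0 y≡x = trans (eval-auxiliary D x y)
  (cong₂ (λ d e → d * d + e * e) Dx≡0 (trans (cong (_- sumSq x) y≡x) (ℤP.+-inverseʳ (sumSq x))))

interval : ℕ → List ℤ
interval zero    = List.[ + 0 ]
interval (suc B) = + suc B List.∷ -[1+ B ] List.∷ interval B

∈-interval : ∀ B a → ∣ a ∣ ℕ.≤ B → a ∈ interval B
∈-interval zero    (+ zero)  _ = here refl
∈-interval (suc B) (+ m)     a≤B with ℕP.m≤n⇒m<n∨m≡n a≤B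
... | inj₁ (s≤s a<B) = there (there (∈-interval B (+ m) a<B))
... | inj₂ refl      = here refl
∈-interval (suc B) -[1+ m ] (s≤s a≤B) with ℕP.m≤n⇒m<n∨m≡n a≤B
... | inj₁ a<B = there (there (∈-interval B -[1+ m ] a<B))
... | inj₂ refl = there (here refl)

box : ∀ k → ℕ → List (Vec ℤ k)
box zero    B = List.[ [] ]
box (suc k) B = cartesianProductWith _∷_ (interval B) (box k B)

∈-box : ∀ {k} B (v : Vec ℤ k) → Bounded B v → v ∈ box k B
∈-box B []      []          = here refl
∈-box B (a ∷ v) (a≤B ∷ v≤B) = ∈P.∈-cartesianProductWith⁺ _∷_ (∈-interval B a a≤B) (∈-box B v v≤B)

enumerate-bounded : ∀ {k} (D : Poly k) B → (∀ z → IsSolution D z → Bounded B z) →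
  Σ (List (Vec ℤ k)) (Enumerates D)
enumerate-bounded {k} D B bounded =
  solutions , deduplicate-! _≟_ candidates , λ z → sound z , complete z
  where
  _≟_ : DecidableEquality (Vec ℤ k)
  _≟_ = VecP.≡-dec ℤP._≟_
  solves? : Decidable (IsSolution D)
  solves? z = eval D z ℤP.≟ + 0
  candidates solutions : List (Vec ℤ k)
  candidates = filter solves? (box k B)
  solutions  = deduplicate _≟_ candidates
  sound : ∀ z → z ∈ solutions → IsSolution D z
  sound z z∈ = proj₂ (∈P.∈-filter⁻ solves? {xs = box k B} (∈P.∈-deduplicate⁻ _≟_ candidates z∈))
  complete : ∀ z → IsSolution D z → z ∈ solutions
  complete z sol = ∈P.∈-deduplicate⁺ _≟_ (∈P.∈-filter⁺ solves? (∈-box B z (bounded z sol)) sol)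

distinct-members≤length : ∀ {m} {A : Set} {l : List A} (g : Fin m → A) →
  (∀ {s t} → g s ≡ g t → s ≡ t) → (∀ t → g t ∈ l) → m ℕ.≤ length l
distinct-members≤length {l = l} g injective member = FinP.injective⇒≤ {f = index ∘ member} λ {s} {t} e →
  injective (trans (AnyP.lookup-index (member s)) (trans (cong (List.lookup l) e) (sym (AnyP.lookup-index (member t)))))

n≤n*n : ∀ n → n ℕ.≤ n ℕ.* n
n≤n*n zero    = z≤n
n≤n*n (suc n) = ℕP.m≤m*n (suc n) (suc n)

bounded-by-sumSq : ∀ {k} (v : Vec ℤ k) → Bounded (sumSqℕ v) v
bounded-by-sumSq []      = []
bounded-by-sumSq (a ∷ v) = ℕP.≤-trans (n≤n*n ∣ a ∣) (ℕP.m≤m+n _ _)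
                         ∷ All.map (λ b≤ → ℕP.≤-trans b≤ (ℕP.m≤n+m _ _)) (bounded-by-sumSq v)

height≤sumSq : ∀ {k} (v : Vec ℤ k) → height v ℕ.≤ sumSqℕ v
height≤sumSq []      = z≤n
height≤sumSq (a ∷ v) = ℕP.⊔-lub (ℕP.≤-trans (n≤n*n ∣ a ∣) (ℕP.m≤m+n _ _))
                                (ℕP.≤-trans (height≤sumSq v) (ℕP.m≤n+m _ _))

total : ∀ {k} → List (Vec ℤ k) → ℕ
total = List.foldr (λ x s → sumSqℕ x ℕ.+ s) 0

sumSq≤total : ∀ {k} {x : Vec ℤ k} l → x ∈ l → sumSqℕ x ℕ.≤ total l
sumSq≤total (y List.∷ l) (here refl) = ℕP.m≤m+n _ _
sumSq≤total (y List.∷ l) (there x∈) = ℕP.≤-trans (sumSq≤total l x∈) (ℕP.m≤n+m _ _)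

sumSq-++ : ∀ {k l} (u : Vec ℤ k) (v : Vec ℤ l) → sumSq (u ++ v) ≡ sumSq u + sumSq v
sumSq-++ []      v = sym (ℤP.+-identityˡ (sumSq v))
sumSq-++ (a ∷ u) v = trans (cong (λ s → a * a + s) (sumSq-++ u v)) (sym (ℤP.+-assoc (a * a) (sumSq u) (sumSq v)))

fourSquareRep : ℕ → Vec ℤ 4
fourSquareRep s = proj₁ (lagrange s)

sumSq-fourSquareRep : ∀ s → sumSq (fourSquareRep s) ≡ + s
sumSq-fourSquareRep s = proj₂ (lagrange s)

-- If D has the finite solution set l, every solution (x, y) of the auxiliary equation
-- has x ∈ l and |y|² = |x|², so all its entries are bounded by the total of |x|² over l.
auxiliary-finite : ∀ {n} (D : Poly n) l → Enumerates D l → Σ (List (Vec ℤ (n ℕ.+ 8))) (Enumerates (auxiliary D))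
auxiliary-finite {n} D l (_ , solutions) = enumerate-bounded (auxiliary D) (total l) bounded
  where
  bounded : ∀ z → IsSolution (auxiliary D) z → Bounded (total l) z
  bounded z sol with Vec.splitAt n z
  ... | x , y , refl with auxiliary-sound D x y sol
  ...   | Dx≡0 , y≡x = ++⁺ (All.map (λ a≤ → ℕP.≤-trans a≤ x≤total) (bounded-by-sumSq x))
                           (All.map (λ a≤ → ℕP.≤-trans a≤ (ℕP.≤-trans (ℕP.≤-reflexive y≡xℕ) x≤total)) (bounded-by-sumSq y))
    where
    x≤total : sumSqℕ x ℕ.≤ total l
    x≤total = sumSq≤total l (proj₂ (solutions x) Dx≡0)
    y≡xℕ : sumSqℕ y ≡ sumSqℕ x
    y≡xℕ = ℤP.+-injective (trans (sym (sumSq≡sumSqℕ y)) (trans y≡x (sumSq≡sumSqℕ x)))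

-- A solution x of D of height h yields h + 1 distinct solutions (x, u, v) of the
-- auxiliary equation: u and v are four-square representations of t and |x|² − t
-- for t = 0, …, h (note h ≤ |x|²).
height<solutions : ∀ {n} (D : Poly n) x l′ → IsSolution D x → Enumerates (auxiliary D) l′ →
  height x ℕ.< length l′
height<solutions {n} D x l′ sol (_ , solutions′) = distinct-members≤length lift injective member
  where
  M : ℕ
  M = sumSqℕ x
  lift : Fin (suc (height x)) → Vec ℤ (n ℕ.+ 8)
  lift t = x ++ (fourSquareRep (toℕ t) ++ fourSquareRep (M ℕ.∸ toℕ t))
  balanced : ∀ t → sumSq (fourSquareRep (toℕ t) ++ fourSquareRep (M ℕ.∸ toℕ t)) ≡ sumSq x
  balanced t = begin
    sumSq (fourSquareRep (toℕ t) ++ fourSquareRep (M ℕ.∸ toℕ t))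
      ≡⟨ sumSq-++ (fourSquareRep (toℕ t)) (fourSquareRep (M ℕ.∸ toℕ t)) ⟩
    sumSq (fourSquareRep (toℕ t)) + sumSq (fourSquareRep (M ℕ.∸ toℕ t))
      ≡⟨ cong₂ _+_ (sumSq-fourSquareRep (toℕ t)) (sumSq-fourSquareRep (M ℕ.∸ toℕ t)) ⟩
    + toℕ t + + (M ℕ.∸ toℕ t)
      ≡⟨ sym (ℤP.pos-+ (toℕ t) (M ℕ.∸ toℕ t)) ⟩
    + (toℕ t ℕ.+ (M ℕ.∸ toℕ t))
      ≡⟨ cong +_ (ℕP.m+[n∸m]≡n (ℕP.≤-trans (ℕP.≤-pred (FinP.toℕ<n t)) (height≤sumSq x))) ⟩
    + M
      ≡⟨ sym (sumSq≡sumSqℕ x) ⟩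
    sumSq x ∎
    where open ≡-Reasoning
  member : ∀ t → lift t ∈ l′
  member t = proj₂ (solutions′ (lift t)) (auxiliary-complete D x _ sol (balanced t))
  injective : ∀ {s t} → lift s ≡ lift t → s ≡ t
  injective {s} {t} e = FinP.toℕ-injective (ℤP.+-injective (begin
    + toℕ s                       ≡⟨ sym (sumSq-fourSquareRep (toℕ s)) ⟩
    sumSq (fourSquareRep (toℕ s)) ≡⟨ cong sumSq (VecP.++-injectiveˡ (fourSquareRep (toℕ s)) (fourSquareRep (toℕ t)) (VecP.++-injectiveʳ x x e)) ⟩
    sumSq (fourSquareRep (toℕ t)) ≡⟨ sumSq-fourSquareRep (toℕ t) ⟩
    + toℕ t                       ∎))
    where open ≡-Reasoning

theorem1 : (f : (n : ℕ) → Poly n → ℤ) → BoundsCount f →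
    Σ ((n : ℕ) → Poly n → ℤ) BoundsHeights
theorem1 f bounds-count = (λ n D → f (n ℕ.+ 8) (auxiliary D)) , bounds-height
  where
  bounds-height : BoundsHeights (λ n D → f (n ℕ.+ 8) (auxiliary D))
  bounds-height n D l enum x sol with auxiliary-finite D l enum
  ... | l′ , enum′ = ℤP.<-trans (+<+ (height<solutions D x l′ sol enum′)) (bounds-count (n ℕ.+ 8) (auxiliary D) l′ enum′)
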